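{- Let $\Gamma$ be a graph of order $n$ with maximum degree $\delta_1$ and minimum degree $\delta_n$, and write $A(\Gamma;x)=x^n\sum_{k\in\mathcal{K}}A_k(\Gamma)x^k$. Let $\mathrm{Deg}_{\min}(A(\Gamma;x))$ and $\mathrm{Deg}(A(\Gamma;x))$ denote the smallest and largest exponents of $x$ appearing with nonzero coefficient. Then: (i) $\mathrm{Deg}_{\min}(A(\Gamma;x))=n-\delta_1$, and $A_{ -\delta_1}(\Gamma)$ is the number of vertices of $\Gamma$ of degree $\delta_1$; (ii) $A_{ -\delta_1+1}(\Gamma)$ is the number of vertices of $\Gamma$ of degree $\delta_1-1$; (iii) $A_{\delta_n}(\Gamma)>0$; (iv) $n+\delta_n\le \mathrm{Deg}(A(\Gamma;x))\le n+\delta_1$; (v) $A_{\delta_1}(\Gamma)$ equals the number of connected components of $\Gamma$ which are $\delta_1$-regular; (vi) there is no defensive $k$-alliance in $\Gamma$ for any $k>\mathrm{Deg}(A(\Gamma;x))-n$.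
   Context: All graphs are finite and simple with at least one vertex. For $\Gamma=(V,E)$, a vertex $v$ and $X\subseteq V$, $\delta_X(v)$ is the number of neighbours of $v$ in $X$, $\bar S=V\setminus S$, and $\mathcal{K}=[-\delta_1,\delta_1]\cap\mathbb{Z}$. A nonempty $S\subseteq V$ is a defensive $k$-alliance (for an integer $k$) if $\delta_S(v)\ge\delta_{\bar S}(v)+k$ for all $v\in S$; its exact index of alliance is $k_S=\max\{k\in\mathcal{K}: S \text{ is a defensive } k\text{ -alliance}\}$. The alliance polynomial is $A(\Gamma;x)=\sum_{S} x^{n+k_S}$, the sum over all nonempty $S\subseteq V$ with induced subgraph $\langle S\rangle$ connected; thus $A_k(\Gamma)$ is the number of nonempty $S$ with $\langle S\rangle$ connected and $k_S=k$. -}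

module Defs where

open import Data.Bool using (Bool; true; false; _∧_; if_then_else_)
open import Data.Nat as ℕ using (ℕ; _<_)
open import Data.Integer as ℤ using (ℤ; +_; -_)
open import Data.Fin using (Fin)
open import Data.Fin.Subset using (Subset; _∈_; _⊆_; ∁; ⊤; Nonempty)
open import Data.Vec using (lookup)
open import Data.List using (List; allFin; map; length)
open import Data.Nat.ListAction using (sum)
open import Data.List.Relation.Unary.Unique.Propositional using (Unique)
open import Data.List.Membership.Propositional renaming (_∈_ to _∈L_)
open import Data.Product using (Σ; ∃; ∃-syntax; _×_)
open import Function.Bundles using (_⇔_)
open import Relation.Binary.PropositionalEquality using (_≡_)
open import Relation.Nullary using (¬_)

record Graph (n : ℕ) : Set where
  field
    adj   : Fin n → Fin n → Bool
    sym   : ∀ u v → adj u v ≡ adj v u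
    irrefl : ∀ v → adj v v ≡ false
open Graph public

module _ {n : ℕ} (Γ : Graph n) where

  δ : Subset n → Fin n → ℕ
  δ X v = sum (map (λ w → if adj Γ v w ∧ lookup X w then 1 else 0) (allFin n))

  deg : Fin n → ℕ
  deg v = δ ⊤ v

  IsMaxDeg : ℕ → Set
  IsMaxDeg d = (∃[ v ] deg v ≡ d) × (∀ v → deg v ℕ.≤ d)

  IsMinDeg : ℕ → Set
  IsMinDeg d = (∃[ v ] deg v ≡ d) × (∀ v → d ℕ.≤ deg v)

  DefAlliance : Subset n → ℤ → Set
  DefAlliance S k = Nonempty S ×
    (∀ v → v ∈ S → + δ S v ℤ.≥ + δ (∁ S) v ℤ.+ k)

  data Reach (S : Subset n) : Fin n → Fin n → Set where
    here : ∀ {u} → Reach S u u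
    step : ∀ {u w v} → adj Γ u w ≡ true → w ∈ S → Reach S w v → Reach S u v

  Connected : Subset n → Set
  Connected S = ∀ u v → u ∈ S → v ∈ S → Reach S u v

  -- k ∈ 𝒦 = [-δ₁, δ₁] ∩ ℤ, where δ₁ is the maximum degree
  InK : ℕ → ℤ → Set
  InK δ₁ k = (- (+ δ₁) ℤ.≤ k) × (k ℤ.≤ + δ₁)

  ExactIndex : ℕ → Subset n → ℤ → Set
  ExactIndex δ₁ S k = InK δ₁ k × DefAlliance S k ×
    (∀ k′ → InK δ₁ k′ → DefAlliance S k′ → k′ ℤ.≤ k)

  -- S contributes the monomial x^(n + k) to A(Γ;x)
  Term : ℕ → Subset n → ℤ → Set
  Term δ₁ S k = Nonempty S × Connected S × ExactIndex δ₁ S k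

  ACounted : ℕ → ℤ → Subset n → Set
  ACounted δ₁ k S = Term δ₁ S k

  Exponent : ℕ → ℤ → Set
  Exponent δ₁ e = ∃[ S ] ∃[ k ] (Term δ₁ S k × e ≡ + n ℤ.+ k)

  IsDegMin : ℕ → ℤ → Set
  IsDegMin δ₁ d = Exponent δ₁ d × (∀ e → Exponent δ₁ e → d ℤ.≤ e)

  IsDeg : ℕ → ℤ → Set
  IsDeg δ₁ d = Exponent δ₁ d × (∀ e → Exponent δ₁ e → e ℤ.≤ d)

  IsComponent : Subset n → Set
  IsComponent C = Nonempty C × Connected C ×
    (∀ D → Connected D → C ⊆ D → D ≡ C)

  RegularComponent : ℕ → Subset n → Set
  RegularComponent r C = IsComponent C × (∀ v → v ∈ C → deg v ≡ r)

HasCount : {A : Set} → (A → Set) → ℕ → Set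
HasCount {A} P m = Σ (List A) λ l → Unique l × (∀ x → (x ∈L l) ⇔ P x) × length l ≡ m

module Submission where

-- Throughout, D is the maximum degree, so every exact index
-- lies in [-D, D].  The argument rests on four observations.
--   * Every nonempty S is a (-D)-alliance and no alliance has index above
--     the degree of any of its vertices; since alliance-hood is decidable and
--     the index range is finite, every nonempty S has an exact index k_S.
--   * A singleton {v} has k = -deg v, and a connected set with at least two
--     vertices is a (2-D)-alliance; hence the sets counted by A_k for
--     k <= 1-D are exactly the singletons {v} with -deg v = k: parts (i), (ii).
--   * A set closed under adjacency (no edge leaves it) has exact index equal
--     to its minimum degree; the component of a vertex of minimum degree gives
--     A_{δn} > 0 and the lower bound of (iii)/(iv), and S has index D exactly
--     when S is a D-regular component: part (v).
--   * A k-alliance restricts to a k-alliance on each of its connected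
--     components, which yields part (vi).

open import Defs
open import Data.Bool as Bool using (true; false; _∧_; if_then_else_)
open import Data.Nat as ℕ using (ℕ; zero; suc; _+_; _≤_; _<_; z≤n; s≤s)
import Data.Nat.Properties as ℕP
open import Data.Integer as ℤ using (ℤ; +_; -_; +≤+)
import Data.Integer.Properties as ℤP
open import Data.Integer.Tactic.RingSolver using (solve-∀)
import Data.Nat.Tactic.RingSolver as ℕSolver
open import Data.Fin using (Fin) renaming (_≟_ to _≟ᶠ_)
import Data.Fin.Properties as FinP
open import Data.Fin.Subset
  using (Subset; _∈_; _∉_; _⊆_; ∁; ⊤; ⁅_⁆; _∪_; Nonempty; _-_; ∣_∣; inside; outside)
open import Data.Fin.Subset.Properties
  using (_∈?_; nonempty?; anySubset?; ∈⊤; x∈⁅x⁆; x∈⁅y⁆⇒x≡y; ⊆-antisym; p⊆p∪q; q⊆p∪q; x∈p∪q⁻;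
         x∈∁p⇒x∉p; x∉p⇒x∈∁p; x∉∁p⇒x∈p; x∈p⇒∣p-x∣<∣p∣; x∈p∧x≢y⇒x∈p-y; p─q⊆p; ∣p∣≤n)
open import Data.Vec using ([]; _∷_; lookup; tabulate)
open import Data.Vec.Properties
  using ([]=⇒lookup; lookup⇒[]=; lookup-map; lookup-replicate; lookup∘tabulate; ∷-injectiveʳ)
open import Data.List using (List; []; _∷_; map; _++_; filter; length; allFin)
open import Data.List.Properties using (length-map)
open import Data.Nat.ListAction using (sum)
open import Data.List.Membership.Propositional using () renaming (_∈_ to _∈L_)
open import Data.List.Membership.Propositional.Properties
  using (∈-allFin; ∈-map⁺; ∈-map⁻; ∈-++⁺ˡ; ∈-++⁺ʳ; ∈-filter⁺; ∈-filter⁻)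
open import Data.List.Relation.Unary.Any using (here; there)
import Data.List.Relation.Unary.All as All
open import Data.List.Relation.Unary.Unique.Propositional using (Unique; []; _∷_)
import Data.List.Relation.Unary.Unique.Propositional.Properties as UniqueP
open import Data.List.Relation.Binary.Disjoint.Propositional using (Disjoint)
open import Data.Product using (∃; ∃-syntax; _×_; _,_; proj₁; proj₂)
open import Data.Sum using (_⊎_; inj₁; inj₂)
open import Data.Empty using (⊥-elim)
open import Function.Bundles using (_⇔_; mk⇔; Equivalence)
open import Relation.Binary.PropositionalEquality
  using (_≡_; _≢_; refl; cong; cong₂; subst; subst₂; trans; module ≡-Reasoning)
  renaming (sym to ≡-sym)
open import Relation.Nullary using (¬_; Dec; yes; no; does)
open import Relation.Nullary.Decidable using (map′; _×-dec_; _→-dec_; ¬?)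
open import Relation.Unary using (Decidable)

open Equivalence using (to; from)
open import Algebra.Properties.CommutativeSemigroup ℕP.+-commutativeSemigroup
  using () renaming (interchange to +-interchange)

-- Counting: a predicate on a finite type is counted by filtering an enumeration.

subsets : ∀ n → List (Subset n)
subsets zero    = [] ∷ []
subsets (suc n) = map (inside ∷_) (subsets n) ++ map (outside ∷_) (subsets n)

∈-subsets : ∀ {n} (S : Subset n) → S ∈L subsets n
∈-subsets []                  = here refl
∈-subsets (inside ∷ S)        = ∈-++⁺ˡ (∈-map⁺ (inside ∷_) (∈-subsets S))
∈-subsets {suc n} (outside ∷ S) =
  ∈-++⁺ʳ (map (inside ∷_) (subsets n)) (∈-map⁺ (outside ∷_) (∈-subsets S))

subsets-unique : ∀ n → Unique (subsets n)
subsets-unique zero    = All.[] ∷ []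
subsets-unique (suc n) =
  UniqueP.++⁺ (UniqueP.map⁺ ∷-injectiveʳ (subsets-unique n))
              (UniqueP.map⁺ ∷-injectiveʳ (subsets-unique n)) separated
  where
  -- the two halves differ in the first coordinate
  separated : Disjoint (map (inside ∷_) (subsets n)) (map (outside ∷_) (subsets n))
  separated (p , q) with ∈-map⁻ (inside ∷_) p | ∈-map⁻ (outside ∷_) q
  ... | _ , _ , refl | _ , _ , ()

HasCount-filter : ∀ {A : Set} {xs : List A} → Unique xs → (∀ x → x ∈L xs) →
                  {P : A → Set} (P? : Decidable P) → HasCount P (length (filter P? xs))
HasCount-filter {xs = xs} unique complete P? =
  filter P? xs , UniqueP.filter⁺ P? unique ,
  (λ x → mk⇔ (λ m → proj₂ (∈-filter⁻ P? {xs = xs} m)) (∈-filter⁺ P? (complete x))) , refl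

count-vertices : ∀ {n} {P : Fin n → Set} (P? : Decidable P) → ∃[ m ] HasCount P m
count-vertices {n} P? = _ , HasCount-filter (UniqueP.allFin⁺ n) ∈-allFin P?

count-subsets : ∀ {n} {P : Subset n → Set} (P? : Decidable P) → ∃[ m ] HasCount P m
count-subsets {n} P? = _ , HasCount-filter (subsets-unique n) ∈-subsets P?

HasCount-⇔ : ∀ {A : Set} {P Q : A → Set} {m} → (∀ x → P x ⇔ Q x) →
             HasCount P m → HasCount Q m
HasCount-⇔ P⇔Q (l , unique , members , len) =
  l , unique , (λ x → mk⇔ (λ m → to (P⇔Q x) (to (members x) m))
                          (λ q → from (members x) (from (P⇔Q x) q))) , len

HasCount-image : ∀ {A B : Set} {P : A → Set} {Q : B → Set} {m} (g : A → B) →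
                 (∀ {x y} → g x ≡ g y → x ≡ y) →
                 (∀ b → Q b ⇔ (∃[ a ] (P a × b ≡ g a))) → HasCount P m → HasCount Q m
HasCount-image {P = P} {Q} g g-inj image (l , unique , members , len) =
  map g l , UniqueP.map⁺ g-inj unique , (λ b → mk⇔ (listed⇒Q b) (Q⇒listed b)) ,
  trans (length-map g l) len
  where
  listed⇒Q : ∀ b → b ∈L map g l → Q b
  listed⇒Q b m with ∈-map⁻ g m
  ... | a , a∈l , refl = from (image b) (a , to (members a) a∈l , refl)
  Q⇒listed : ∀ b → Q b → b ∈L map g l
  Q⇒listed b q with to (image b) q
  ... | a , Pa , refl = ∈-map⁺ g (from (members a) Pa)

HasCount-pos : ∀ {A : Set} {P : A → Set} {m x} → HasCount P m → P x → 0 < m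
HasCount-pos {x = x} (l , _ , members , refl) Px with from (members x) Px
... | here _  = s≤s z≤n
... | there _ = s≤s z≤n

module _ {A : Set} where

  sum-mono : (f g : A → ℕ) → (∀ x → f x ≤ g x) → ∀ l → sum (map f l) ≤ sum (map g l)
  sum-mono f g f≤g []      = z≤n
  sum-mono f g f≤g (x ∷ l) = ℕP.+-mono-≤ (f≤g x) (sum-mono f g f≤g l)

  sum-+ : (f g h : A → ℕ) → (∀ x → f x + g x ≡ h x) → ∀ l →
          sum (map f l) + sum (map g l) ≡ sum (map h l)
  sum-+ f g h f+g≡h []      = refl
  sum-+ f g h f+g≡h (x ∷ l) =
    trans (+-interchange (f x) (sum (map f l)) (g x) (sum (map g l)))
          (cong₂ _+_ (f+g≡h x) (sum-+ f g h f+g≡h l))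

  sum-zero : (f : A → ℕ) → (∀ x → f x ≡ 0) → ∀ l → sum (map f l) ≡ 0
  sum-zero f f≡0 []      = refl
  sum-zero f f≡0 (x ∷ l) rewrite f≡0 x = sum-zero f f≡0 l

  sum-zero⁻ : (f : A → ℕ) → ∀ l → sum (map f l) ≡ 0 → ∀ {x} → x ∈L l → f x ≡ 0
  sum-zero⁻ f (y ∷ l) s≡0 (here refl) = ℕP.m+n≡0⇒m≡0 (f y) s≡0
  sum-zero⁻ f (y ∷ l) s≡0 (there m)   = sum-zero⁻ f l (ℕP.m+n≡0⇒n≡0 (f y) s≡0) m

  sum-pos : (f : A → ℕ) → ∀ l {x} → x ∈L l → 1 ≤ f x → 1 ≤ sum (map f l)
  sum-pos f (y ∷ l) (here refl) 1≤fy = ℕP.≤-trans 1≤fy (ℕP.m≤m+n (f y) _)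
  sum-pos f (y ∷ l) (there m)   1≤fx = ℕP.≤-trans (sum-pos f l m 1≤fx) (ℕP.m≤n+m _ (f y))

-- Bounded maximisation: a decidable predicate on a finite range has a largest solution.

max-below : (Q : ℕ → Set) → Decidable Q → ∀ B a → a ≤ B → Q a →
            ∃[ t ] (t ≤ B × a ≤ t × Q t × (∀ t′ → t′ ≤ B → Q t′ → t′ ≤ t))
max-below Q Q? zero a a≤B Qa =
  a , a≤B , ℕP.≤-refl , Qa , λ { zero _ _ → z≤n ; (suc _) () _ }
max-below Q Q? (suc B) a a≤B Qa with Q? (suc B)
... | yes QB = suc B , ℕP.≤-refl , a≤B , QB , λ _ t′≤B _ → t′≤B
... | no ¬QB with ℕP.m≤n⇒m<n∨m≡n a≤B
...   | inj₂ refl          = ⊥-elim (¬QB Qa)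
...   | inj₁ (s≤s a≤B-1) with max-below Q Q? B a a≤B-1 Qa
...     | t , t≤B , a≤t , Qt , largest = t , ℕP.m≤n⇒m≤1+n t≤B , a≤t , Qt , largest′
  where
  largest′ : ∀ t′ → t′ ≤ suc B → Q t′ → t′ ≤ t
  largest′ t′ t′≤ Qt′ with ℕP.m≤n⇒m<n∨m≡n t′≤
  ... | inj₁ (s≤s t′≤B) = largest t′ t′≤B Qt′
  ... | inj₂ refl        = ⊥-elim (¬QB Qt′)

Within : ℕ → ℤ → Set
Within D k = (- (+ D) ℤ.≤ k) × (k ℤ.≤ + D)

≤-via-ℕ : ∀ {i j : ℤ} (a b : ℕ) → j ℤ.- i ≡ + a ℤ.- + b → b ≤ a → i ℤ.≤ j
≤-via-ℕ a b j-i≡a-b b≤a =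
  ℤP.0≤i-j⇒j≤i (subst (ℤ.+0 ℤ.≤_) (≡-sym j-i≡a-b) (ℤP.i≤j⇒0≤j-i (+≤+ b≤a)))

shift : ℕ → ℕ → ℤ
shift D j = + j ℤ.- + D

shift-within : ∀ D j → j ≤ D + D → Within D (shift D j)
shift-within D j j≤2D = ≤-via-ℕ j 0 (lower-gap (+ j) (+ D)) z≤n ,
                        ≤-via-ℕ (D + D) j (upper-gap (+ j) (+ D)) j≤2D
  where
  lower-gap : ∀ J C → (J ℤ.- C) ℤ.- (- C) ≡ J ℤ.- + 0
  lower-gap = solve-∀
  upper-gap : ∀ J C → C ℤ.- (J ℤ.- C) ≡ (C ℤ.+ C) ℤ.- J
  upper-gap = solve-∀

within-shift : ∀ D k → Within D k → ∃[ j ] (j ≤ D + D × k ≡ shift D j)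
within-shift D k (lo , hi) =
  ℤ.∣ k ℤ.+ + D ∣ , j≤2D , trans (unshift k (+ D)) (cong (ℤ._- + D) (≡-sym j≡k+D))
  where
  unshift : ∀ K C → K ≡ (K ℤ.+ C) ℤ.- C
  unshift = solve-∀
  0≤k+D : ℤ.+0 ℤ.≤ k ℤ.+ + D
  0≤k+D = subst (λ z → ℤ.+0 ℤ.≤ k ℤ.+ z) (ℤP.neg-involutive (+ D)) (ℤP.i≤j⇒0≤j-i lo)
  j≡k+D : + ℤ.∣ k ℤ.+ + D ∣ ≡ k ℤ.+ + D
  j≡k+D = ℤP.0≤i⇒+∣i∣≡i 0≤k+D
  j≤2D : ℤ.∣ k ℤ.+ + D ∣ ≤ D + D
  j≤2D = ℤP.drop‿+≤+ (subst (ℤ._≤ + (D + D)) (≡-sym j≡k+D) (ℤP.+-monoˡ-≤ (+ D) hi))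

max-within : ∀ D (R : ℤ → Set) → Decidable R → ∀ k₀ → Within D k₀ → R k₀ →
             ∃[ k ] (Within D k × R k × k₀ ℤ.≤ k × (∀ k′ → Within D k′ → R k′ → k′ ℤ.≤ k))
max-within D R R? k₀ k₀∈ Rk₀ with within-shift D k₀ k₀∈
... | a , a≤2D , refl
  with max-below (λ j → R (shift D j)) (λ j → R? (shift D j)) (D + D) a a≤2D Rk₀
... | t , t≤2D , a≤t , Rt , largest =
  shift D t , shift-within D t t≤2D , Rt , ℤP.+-monoˡ-≤ (- + D) (+≤+ a≤t) , largest′
  where
  largest′ : ∀ k′ → Within D k′ → R k′ → k′ ℤ.≤ shift D t
  largest′ k′ k′∈ Rk′ with within-shift D k′ k′∈
  ... | j , j≤2D , refl = ℤP.+-monoˡ-≤ (- + D) (+≤+ (largest j j≤2D Rk′))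

∈⇒lookup : ∀ {n} {x : Fin n} {X : Subset n} → x ∈ X → lookup X x ≡ true
∈⇒lookup = []=⇒lookup

lookup⇒∈ : ∀ {n} {x : Fin n} {X : Subset n} → lookup X x ≡ true → x ∈ X
lookup⇒∈ {x = x} {X} = lookup⇒[]= x X

∉⇒lookup : ∀ {n} {x : Fin n} {X : Subset n} → x ∉ X → lookup X x ≡ false
∉⇒lookup {x = x} {X} x∉X with lookup X x in eq
... | true  = ⊥-elim (x∉X (lookup⇒∈ eq))
... | false = refl

singleton-or-other : ∀ {n} {S : Subset n} {v} → v ∈ S → S ≡ ⁅ v ⁆ ⊎ ∃[ u ] (u ∈ S × u ≢ v)
singleton-or-other {S = S} {v} v∈S with FinP.any? (λ u → (u ∈? S) ×-dec ¬? (u ≟ᶠ v))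
... | yes other = inj₂ other
... | no ¬other = inj₁ (⊆-antisym only-v (λ u∈⁅v⁆ → subst (_∈ S) (≡-sym (x∈⁅y⁆⇒x≡y v u∈⁅v⁆)) v∈S))
  where
  only-v : S ⊆ ⁅ v ⁆
  only-v {u} u∈S with u ≟ᶠ v
  ... | yes refl = x∈⁅x⁆ v
  ... | no u≢v   = ⊥-elim (¬other (u , u∈S , u≢v))

⁅⁆-injective : ∀ {n} {x y : Fin n} → ⁅ x ⁆ ≡ ⁅ y ⁆ → x ≡ y
⁅⁆-injective {x = x} {y} ⁅x⁆≡⁅y⁆ = x∈⁅y⁆⇒x≡y y (subst (x ∈_) ⁅x⁆≡⁅y⁆ (x∈⁅x⁆ x))

-- Neighbour counts δ_X(v) and closed sets.

module NeighbourCounts {n : ℕ} (Γ : Graph n) where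

  indicator : Subset n → Fin n → Fin n → ℕ
  indicator X v w = if adj Γ v w ∧ lookup X w then 1 else 0

  -- Every neighbour of v lies either in X or in its complement.
  δ-split : ∀ X v → δ Γ X v + δ Γ (∁ X) v ≡ deg Γ v
  δ-split X v = sum-+ (indicator X v) (indicator (∁ X) v) (indicator ⊤ v) pointwise (allFin n)
    where
    pointwise : ∀ w → indicator X v w + indicator (∁ X) v w ≡ indicator ⊤ v w
    pointwise w rewrite lookup-map w Bool.not X | lookup-replicate {n = n} w true
      with adj Γ v w | lookup X w
    ... | true  | true  = refl
    ... | true  | false = refl
    ... | false | _     = refl

  δ≤deg : ∀ X v → δ Γ X v ≤ deg Γ v
  δ≤deg X v = subst (δ Γ X v ≤_) (δ-split X v) (ℕP.m≤m+n _ _)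

  δ-mono : ∀ X Y v → (∀ w → adj Γ v w ≡ true → w ∈ X → w ∈ Y) → δ Γ X v ≤ δ Γ Y v
  δ-mono X Y v X⊆Y = sum-mono (indicator X v) (indicator Y v) pointwise (allFin n)
    where
    pointwise : ∀ w → indicator X v w ≤ indicator Y v w
    pointwise w with adj Γ v w in vw | lookup X w in w∈X
    ... | false | _     = z≤n
    ... | true  | false = z≤n
    ... | true  | true  rewrite ∈⇒lookup (X⊆Y w vw (lookup⇒∈ w∈X)) = s≤s z≤n

  δ≡0 : ∀ X v → (∀ w → adj Γ v w ≡ true → w ∉ X) → δ Γ X v ≡ 0
  δ≡0 X v none = sum-zero (indicator X v) pointwise (allFin n)
    where
    pointwise : ∀ w → indicator X v w ≡ 0
    pointwise w with adj Γ v w in vw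
    ... | false = refl
    ... | true  rewrite ∉⇒lookup (none w vw) = refl

  δ≡0⁻ : ∀ X v → δ Γ X v ≡ 0 → ∀ w → adj Γ v w ≡ true → w ∉ X
  δ≡0⁻ X v δ≡0 w vw w∈X
    with sum-zero⁻ (indicator X v) (allFin n) δ≡0 (∈-allFin w)
  ... | summand≡0 rewrite vw | ∈⇒lookup w∈X with summand≡0
  ... | ()

  δ-pos : ∀ X v w → adj Γ v w ≡ true → w ∈ X → 1 ≤ δ Γ X v
  δ-pos X v w vw w∈X = sum-pos (indicator X v) (allFin n) (∈-allFin w) 1≤summand
    where
    1≤summand : 1 ≤ indicator X v w
    1≤summand rewrite vw | ∈⇒lookup w∈X = s≤s z≤n

  -- A vertex is not its own neighbour, so {v} contains none of v's neighbours.
  δ-self : ∀ v → δ Γ ⁅ v ⁆ v ≡ 0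
  δ-self v = δ≡0 ⁅ v ⁆ v (λ w vw w∈⁅v⁆ → not-loop vw (x∈⁅y⁆⇒x≡y v w∈⁅v⁆))
    where
    not-loop : ∀ {w} → adj Γ v w ≡ true → w ≢ v
    not-loop vw refl with trans (≡-sym vw) (irrefl Γ v)
    ... | ()

  δ-outside-self : ∀ v → δ Γ (∁ ⁅ v ⁆) v ≡ deg Γ v
  δ-outside-self v = trans (cong (_+ δ Γ (∁ ⁅ v ⁆) v) (≡-sym (δ-self v))) (δ-split ⁅ v ⁆ v)

  Closed : Subset n → Set
  Closed S = ∀ {x w} → x ∈ S → adj Γ x w ≡ true → w ∈ S

  closed⇒δ-outside≡0 : ∀ {S} → Closed S → ∀ {x} → x ∈ S → δ Γ (∁ S) x ≡ 0
  closed⇒δ-outside≡0 {S} closed {x} x∈S =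
    δ≡0 (∁ S) x (λ w xw w∈∁S → x∈∁p⇒x∉p w∈∁S (closed x∈S xw))

  closed⇒δ≡deg : ∀ {S} → Closed S → ∀ {x} → x ∈ S → δ Γ S x ≡ deg Γ x
  closed⇒δ≡deg {S} closed {x} x∈S = begin
    δ Γ S x                   ≡⟨ ℕP.+-identityʳ _ ⟨
    δ Γ S x + 0               ≡⟨ cong (λ m → δ Γ S x + m) (closed⇒δ-outside≡0 closed x∈S) ⟨
    δ Γ S x + δ Γ (∁ S) x     ≡⟨ δ-split S x ⟩
    deg Γ x                   ∎
    where open ≡-Reasoning

  δ-outside≡0⇒closed : ∀ {S} → (∀ {x} → x ∈ S → δ Γ (∁ S) x ≡ 0) → Closed S
  δ-outside≡0⇒closed {S} none {x} {w} x∈S xw = x∉∁p⇒x∈p (δ≡0⁻ (∁ S) x (none x∈S) w xw)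

-- Walks inside a vertex set, decidable connectivity, and components.

module Walks {n : ℕ} (Γ : Graph n) where

  open NeighbourCounts Γ

  Reach-mono : ∀ {S T u v} → S ⊆ T → Reach Γ S u v → Reach Γ T u v
  Reach-mono S⊆T here            = here
  Reach-mono S⊆T (step uw w∈S r) = step uw (S⊆T w∈S) (Reach-mono S⊆T r)

  Reach-trans : ∀ {S u v w} → Reach Γ S u v → Reach Γ S v w → Reach Γ S u w
  Reach-trans here            r′ = r′
  Reach-trans (step uw w∈S r) r′ = step uw w∈S (Reach-trans r r′)

  Reach-snoc : ∀ {S u v w} → Reach Γ S u v → adj Γ v w ≡ true → w ∈ S → Reach Γ S u w
  Reach-snoc r vw w∈S = Reach-trans r (step vw w∈S here)

  Reach-sym : ∀ {S u v} → u ∈ S → Reach Γ S u v → Reach Γ S v u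
  Reach-sym u∈S here = here
  Reach-sym {u = u} u∈S (step {w = w} uw w∈S r) =
    Reach-snoc (Reach-sym w∈S r) (trans (sym Γ w u) uw) u∈S

  Reach-end : ∀ {S u v} → u ∈ S → Reach Γ S u v → v ∈ S
  Reach-end u∈S here            = u∈S
  Reach-end u∈S (step _ w∈S r) = Reach-end w∈S r

  Reach-closed : ∀ {S T u v} → Closed S → u ∈ S → Reach Γ T u v → v ∈ S
  Reach-closed closed u∈S here            = u∈S
  Reach-closed closed u∈S (step uw _ r) = Reach-closed closed (closed u∈S uw) r

  -- Cutting a walk at its last visit to u: it avoids u, or restarts at u and then avoids u.
  avoid : ∀ {S x v} u → Reach Γ S x v → Reach Γ (S - u) x v ⊎ Reach Γ (S - u) u v
  avoid u here = inj₁ here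
  avoid u (step {w = w} xw w∈S r) with avoid u r
  ... | inj₂ r′ = inj₂ r′
  ... | inj₁ r′ with w ≟ᶠ u
  ...   | yes refl = inj₂ r′
  ...   | no w≢u   = inj₁ (step xw (x∈p∧x≢y⇒x∈p-y w∈S w≢u) r′)

  first-step : ∀ {S u v} → Reach Γ S u v →
               u ≡ v ⊎ ∃[ w ] (adj Γ u w ≡ true × w ∈ S - u × Reach Γ (S - u) w v)
  first-step {u = u} r with avoid u r
  ... | inj₁ here               = inj₁ refl
  ... | inj₁ (step uw w∈S r′)   = inj₂ (_ , uw , w∈S , r′)
  ... | inj₂ here               = inj₁ refl
  ... | inj₂ (step uw w∈S r′)   = inj₂ (_ , uw , w∈S , r′)

  -- Reachability is decidable, by induction on the number of vertices still available.
  Reach?′ : ∀ b S u v → ∣ S - u ∣ < b → Dec (Reach Γ S u v)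
  Reach?′ zero    S u v ()
  Reach?′ (suc b) S u v (s≤s size<b) with u ≟ᶠ v
  ... | yes refl = yes here
  ... | no u≢v   = map′ restore split (FinP.any? first-step?)
    where
    FirstStep : Fin n → Set
    FirstStep w = adj Γ u w ≡ true × w ∈ S - u × Reach Γ (S - u) w v
    restore : ∃ FirstStep → Reach Γ S u v
    restore (w , uw , w∈S-u , r) = step uw (p─q⊆p S ⁅ u ⁆ w∈S-u) (Reach-mono (p─q⊆p S ⁅ u ⁆) r)
    split : Reach Γ S u v → ∃ FirstStep
    split r with first-step r
    ... | inj₁ u≡v = ⊥-elim (u≢v u≡v)
    ... | inj₂ fs  = fs
    first-step? : Decidable FirstStep
    first-step? w with adj Γ u w Bool.≟ true | w ∈? (S - u)
    ... | no ¬uw | _       = no (λ fs → ¬uw (proj₁ fs))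
    ... | yes _  | no w∉   = no (λ fs → w∉ (proj₁ (proj₂ fs)))
    ... | yes uw | yes w∈  = map′ (λ r → uw , w∈ , r) (λ fs → proj₂ (proj₂ fs))
      (Reach?′ b (S - u) w v (ℕP.<-≤-trans (x∈p⇒∣p-x∣<∣p∣ w∈) size<b))

  Reach? : ∀ S u v → Dec (Reach Γ S u v)
  Reach? S u v = Reach?′ (suc n) S u v (s≤s (∣p∣≤n (S - u)))

  singleton-connected : ∀ v → Connected Γ ⁅ v ⁆
  singleton-connected v u w u∈ w∈ rewrite x∈⁅y⁆⇒x≡y v u∈ | x∈⁅y⁆⇒x≡y v w∈ = here

  connected⇒neighbour : ∀ {S x y} → Connected Γ S → x ∈ S → y ∈ S → x ≢ y →
                        ∃[ w ] (adj Γ x w ≡ true × w ∈ S)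
  connected⇒neighbour {x = x} {y} conn x∈S y∈S x≢y with conn x y x∈S y∈S
  ... | here           = ⊥-elim (x≢y refl)
  ... | step xw w∈S _ = _ , xw , w∈S

  Connected? : ∀ S → Dec (Connected Γ S)
  Connected? S = FinP.all? λ u → FinP.all? λ v → (u ∈? S) →-dec ((v ∈? S) →-dec Reach? S u v)

  connected-extend : ∀ {S x w} → Connected Γ S → x ∈ S → adj Γ x w ≡ true →
                     Connected Γ (S ∪ ⁅ w ⁆)
  connected-extend {S} {x} {w} conn x∈S xw u u′ u∈ u′∈
    with x∈p∪q⁻ S ⁅ w ⁆ u∈ | x∈p∪q⁻ S ⁅ w ⁆ u′∈
  ... | inj₁ u∈S | inj₁ u′∈S = Reach-mono (p⊆p∪q ⁅ w ⁆) (conn u u′ u∈S u′∈S)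
  ... | inj₁ u∈S | inj₂ u′∈w rewrite x∈⁅y⁆⇒x≡y w u′∈w =
    Reach-snoc (Reach-mono (p⊆p∪q ⁅ w ⁆) (conn u x u∈S x∈S)) xw (q⊆p∪q S ⁅ w ⁆ (x∈⁅x⁆ w))
  ... | inj₂ u∈w | inj₁ u′∈S rewrite x∈⁅y⁆⇒x≡y w u∈w =
    step (trans (sym Γ w x) xw) (p⊆p∪q ⁅ w ⁆ x∈S) (Reach-mono (p⊆p∪q ⁅ w ⁆) (conn x u′ x∈S u′∈S))
  ... | inj₂ u∈w | inj₂ u′∈w rewrite x∈⁅y⁆⇒x≡y w u∈w | x∈⁅y⁆⇒x≡y w u′∈w = here

  -- A component is closed: a neighbour outside it could be added.
  component-closed : ∀ {C} → IsComponent Γ C → Closed C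
  component-closed {C} (_ , conn , maximal) {x} {w} x∈C xw =
    subst (w ∈_) (maximal (C ∪ ⁅ w ⁆) (connected-extend conn x∈C xw) (p⊆p∪q ⁅ w ⁆))
          (q⊆p∪q C ⁅ w ⁆ (x∈⁅x⁆ w))

  closed-connected⇒component : ∀ {C} → Nonempty C → Connected Γ C → Closed C → IsComponent Γ C
  closed-connected⇒component {C} ne@(v , v∈C) conn closed = ne , conn , maximal
    where
    maximal : ∀ T → Connected Γ T → C ⊆ T → T ≡ C
    maximal T connT C⊆T = ⊆-antisym (λ {u} u∈T → Reach-closed closed v∈C (connT v u (C⊆T v∈C) u∈T)) C⊆T

  component : Subset n → Fin n → Subset n
  component S v = tabulate λ u → does (Reach? S v u)

  Reach⇒∈component : ∀ {S v u} → Reach Γ S v u → u ∈ component S v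
  Reach⇒∈component {S} {v} {u} r = lookup⇒∈ (trans (lookup∘tabulate _ u) (decided (Reach? S v u)))
    where
    decided : (d : Dec (Reach Γ S v u)) → does d ≡ true
    decided (yes _) = refl
    decided (no ¬r) = ⊥-elim (¬r r)

  ∈component⇒Reach : ∀ {S v u} → u ∈ component S v → Reach Γ S v u
  ∈component⇒Reach {S} {v} {u} u∈ =
    decided (Reach? S v u) (trans (≡-sym (lookup∘tabulate _ u)) (∈⇒lookup u∈))
    where
    decided : (d : Dec (Reach Γ S v u)) → does d ≡ true → Reach Γ S v u
    decided (yes r) _ = r
    decided (no _)  ()

  component-root : ∀ S v → v ∈ component S v
  component-root S v = Reach⇒∈component here

  component⊆ : ∀ {S v} → v ∈ S → component S v ⊆ S
  component⊆ v∈S u∈ = Reach-end v∈S (∈component⇒Reach u∈)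

  component-absorbs : ∀ {S v x w} → x ∈ component S v → adj Γ x w ≡ true → w ∈ S →
                      w ∈ component S v
  component-absorbs {S} {v} x∈ xw w∈S = Reach⇒∈component {S} {v} (Reach-snoc (∈component⇒Reach x∈) xw w∈S)

  Reach-in-component : ∀ {S v x y} → Reach Γ S v x → Reach Γ S x y → Reach Γ (component S v) x y
  Reach-in-component rx here              = here
  Reach-in-component rx (step xw w∈S r) =
    step xw (Reach⇒∈component (Reach-snoc rx xw w∈S)) (Reach-in-component (Reach-snoc rx xw w∈S) r)

  component-connected : ∀ S v → Connected Γ (component S v)
  component-connected S v u w u∈ w∈ =
    Reach-trans (Reach-sym (component-root S v) (Reach-in-component here (∈component⇒Reach u∈)))
                (Reach-in-component here (∈component⇒Reach w∈))

  component-⊤-closed : ∀ v → Closed (component ⊤ v)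
  component-⊤-closed v x∈ xw = component-absorbs {⊤} {v} x∈ xw ∈⊤

-- Defensive alliances and their exact indices.

module Alliances {n : ℕ} (Γ : Graph n) where

  open NeighbourCounts Γ
  open Walks Γ

  -- At a vertex v of a k-alliance, k ≤ δ_S(v) - δ_S̄(v) ≤ deg v.
  alliance-≤-deg : ∀ {S k v} → DefAlliance Γ S k → v ∈ S → k ℤ.≤ + deg Γ v
  alliance-≤-deg {S} {k} {v} (_ , ally) v∈S = begin
    k                    ≤⟨ ℤP.i≤j+i k (+ δ Γ (∁ S) v) ⟩
    + δ Γ (∁ S) v ℤ.+ k  ≤⟨ ally v v∈S ⟩
    + δ Γ S v            ≤⟨ +≤+ (δ≤deg S v) ⟩
    + deg Γ v            ∎
    where open ℤP.≤-Reasoning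

  -- At level j - D the alliance inequality is the ℕ-inequality δ_S̄ + j ≤ δ_S + D.
  shifted-alliance : ∀ {S} D j → Nonempty S →
                     (∀ {x} → x ∈ S → δ Γ (∁ S) x + j ≤ δ Γ S x + D) → DefAlliance Γ S (shift D j)
  shifted-alliance {S} D j ne holds = ne , λ x x∈S →
    ≤-via-ℕ (δ Γ S x + D) (δ Γ (∁ S) x + j)
            (rearrange (+ δ Γ S x) (+ δ Γ (∁ S) x) (+ D) (+ j)) (holds x∈S)
    where
    rearrange : ∀ A B C J → A ℤ.- (B ℤ.+ (J ℤ.- C)) ≡ (A ℤ.+ C) ℤ.- (B ℤ.+ J)
    rearrange = solve-∀

  -- {v} is a (-deg v)-alliance and nothing better: its only vertex has all
  -- neighbours outside.
  singleton-alliance : ∀ v → DefAlliance Γ ⁅ v ⁆ (- + deg Γ v)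
  singleton-alliance v = (v , x∈⁅x⁆ v) , λ w w∈⁅v⁆ → at-v w (x∈⁅y⁆⇒x≡y v w∈⁅v⁆)
    where
    at-v : ∀ w → w ≡ v → + δ Γ (∁ ⁅ v ⁆) w ℤ.+ - + deg Γ v ℤ.≤ + δ Γ ⁅ v ⁆ w
    at-v w refl rewrite δ-outside-self v | δ-self v = ℤP.≤-reflexive (ℤP.+-inverseʳ (+ deg Γ v))

  singleton-alliance-bound : ∀ {v k} → DefAlliance Γ ⁅ v ⁆ k → k ℤ.≤ - + deg Γ v
  singleton-alliance-bound {v} {k} (_ , ally) = begin
    k                                  ≡⟨ cancel k (+ deg Γ v) ⟩
    - + deg Γ v ℤ.+ (+ deg Γ v ℤ.+ k)  ≤⟨ ℤP.+-monoʳ-≤ (- + deg Γ v) at-v ⟩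
    - + deg Γ v ℤ.+ + 0                ≡⟨ ℤP.+-identityʳ _ ⟩
    - + deg Γ v                        ∎
    where
    open ℤP.≤-Reasoning
    cancel : ∀ K d → K ≡ - d ℤ.+ (d ℤ.+ K)
    cancel = solve-∀
    at-v : + deg Γ v ℤ.+ k ℤ.≤ + 0
    at-v = subst₂ (λ a b → + a ℤ.+ k ℤ.≤ + b) (δ-outside-self v) (δ-self v) (ally v (x∈⁅x⁆ v))

  -- On a closed set the condition at x reads k ≤ deg x.
  closed-alliance : ∀ {S r} → Closed S → Nonempty S → (∀ {x} → x ∈ S → r ≤ deg Γ x) →
                    DefAlliance Γ S (+ r)
  closed-alliance {S} {r} closed ne r≤deg = ne , λ x x∈S →
    subst₂ (λ a b → + a ℤ.+ + r ℤ.≤ + b) (≡-sym (closed⇒δ-outside≡0 closed x∈S))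
           (≡-sym (closed⇒δ≡deg closed x∈S)) (+≤+ (r≤deg x∈S))

  -- Restricting a k-alliance S to the component T of one of its vertices keeps a
  -- k-alliance: a vertex of T has all its S-neighbours in T.
  component-alliance : ∀ {S k v} → DefAlliance Γ S k → v ∈ S → DefAlliance Γ (component S v) k
  component-alliance {S} {k} {v} (_ , ally) v∈S = (v , component-root S v) , ally-T
    where
    T = component S v
    ally-T : ∀ x → x ∈ T → + δ Γ (∁ T) x ℤ.+ k ℤ.≤ + δ Γ T x
    ally-T x x∈T = begin
      + δ Γ (∁ T) x ℤ.+ k  ≤⟨ ℤP.+-monoˡ-≤ k (+≤+ (δ-mono (∁ T) (∁ S) x outside-S)) ⟩
      + δ Γ (∁ S) x ℤ.+ k  ≤⟨ ally x (component⊆ v∈S x∈T) ⟩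
      + δ Γ S x            ≤⟨ +≤+ (δ-mono S T x (λ w xw w∈S → absorbed xw w∈S)) ⟩
      + δ Γ T x            ∎
      where
      open ℤP.≤-Reasoning
      absorbed : ∀ {w} → adj Γ x w ≡ true → w ∈ S → w ∈ T
      absorbed xw w∈S = component-absorbs {S} {v} x∈T xw w∈S
      outside-S : ∀ w → adj Γ x w ≡ true → w ∈ ∁ T → w ∈ ∁ S
      outside-S w xw w∈∁T = x∉p⇒x∈∁p (λ w∈S → x∈∁p⇒x∉p w∈∁T (absorbed xw w∈S))

  DefAlliance? : ∀ S k → Dec (DefAlliance Γ S k)
  DefAlliance? S k = nonempty? S ×-dec
    FinP.all? (λ v → (v ∈? S) →-dec (+ δ Γ (∁ S) v ℤ.+ k ℤP.≤? + δ Γ S v))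

  -- From here on D bounds every degree (in the theorem D = δ₁), so every
  -- exact index lies in 𝒦 = [-D, D].
  module MaxDegree (D : ℕ) (deg≤D : ∀ v → deg Γ v ≤ D) where

    alliance-≤-D : ∀ {S k} → DefAlliance Γ S k → k ℤ.≤ + D
    alliance-≤-D ally@((v , v∈S) , _) = ℤP.≤-trans (alliance-≤-deg ally v∈S) (+≤+ (deg≤D v))

    -- Every nonempty set is a (-D)-alliance, since δ_S̄(x) ≤ deg x ≤ D.
    alliance-at-−D : ∀ {S} → Nonempty S → DefAlliance Γ S (- + D)
    alliance-at-−D {S} ne = subst (DefAlliance Γ S) (ℤP.+-identityˡ (- + D)) (shifted-alliance D 0 ne bound)
      where
      bound : ∀ {x} → x ∈ S → δ Γ (∁ S) x + 0 ≤ δ Γ S x + D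
      bound {x} _ = begin
        δ Γ (∁ S) x + 0  ≡⟨ ℕP.+-identityʳ _ ⟩
        δ Γ (∁ S) x      ≤⟨ δ≤deg (∁ S) x ⟩
        deg Γ x          ≤⟨ deg≤D x ⟩
        D                ≤⟨ ℕP.m≤n+m D _ ⟩
        δ Γ S x + D      ∎
        where open ℕP.≤-Reasoning

    -- If every vertex of S has a neighbour in S, then S is a (2 - D)-alliance:
    -- δ_S ≥ 1 and δ_S + δ_S̄ ≤ D give δ_S̄ + 2 ≤ δ_S + D.
    neighbourly-alliance : ∀ {S} → Nonempty S → (∀ {x} → x ∈ S → 1 ≤ δ Γ S x) →
                           DefAlliance Γ S (shift D 2)
    neighbourly-alliance {S} ne 1≤δ = shifted-alliance D 2 ne bound
      where
      bound : ∀ {x} → x ∈ S → δ Γ (∁ S) x + 2 ≤ δ Γ S x + D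
      bound {x} x∈S = begin
        δ Γ (∁ S) x + 2                    ≤⟨ ℕP.+-monoʳ-≤ (δ Γ (∁ S) x) (ℕP.+-mono-≤ (1≤δ x∈S) (1≤δ x∈S)) ⟩
        δ Γ (∁ S) x + (δ Γ S x + δ Γ S x)  ≡⟨ regroup (δ Γ (∁ S) x) (δ Γ S x) ⟩
        δ Γ S x + (δ Γ S x + δ Γ (∁ S) x)  ≤⟨ ℕP.+-monoʳ-≤ (δ Γ S x) (ℕP.≤-trans (ℕP.≤-reflexive (δ-split S x)) (deg≤D x)) ⟩
        δ Γ S x + D                        ∎
        where
        open ℕP.≤-Reasoning
        regroup : ∀ b a → b + (a + a) ≡ a + (a + b)
        regroup = ℕSolver.solve-∀

    exact-index-unique : ∀ {S k k′} → ExactIndex Γ D S k → ExactIndex Γ D S k′ → k ≡ k′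
    exact-index-unique (k∈ , ally , largest) (k′∈ , ally′ , largest′) =
      ℤP.≤-antisym (largest′ _ k∈ ally) (largest _ k′∈ ally′)

    -- The exact index exists: the largest k ∈ [-D, D] at which S is an alliance,
    -- found above the level -D where every nonempty set qualifies.
    exact-index : ∀ {S} → Nonempty S → ∃[ k ] ExactIndex Γ D S k
    exact-index {S} ne with max-within D (DefAlliance Γ S) (DefAlliance? S) (- + D)
                              (ℤP.≤-refl , ℤP.neg-≤-pos) (alliance-at-−D ne)
    ... | k , k∈ , ally , _ , largest = k , k∈ , ally , largest

    ExactIndex? : ∀ S k → Dec (ExactIndex Γ D S k)
    ExactIndex? S k with nonempty? S
    ... | no empty = no λ (_ , (ne , _) , _) → empty ne
    ... | yes ne with exact-index ne
    ...   | kS , exact with k ℤ.≟ kS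
    ...     | yes refl = yes exact
    ...     | no k≢kS  = no λ exact′ → k≢kS (exact-index-unique exact′ exact)

    Term? : ∀ S k → Dec (Term Γ D S k)
    Term? S k = nonempty? S ×-dec (Connected? S ×-dec ExactIndex? S k)

    Term⇒within : ∀ {S k} → Term Γ D S k → Within D k
    Term⇒within (_ , _ , k∈ , _) = k∈

    closed-term : ∀ {S v r} → Closed S → Connected Γ S → v ∈ S → deg Γ v ≡ r →
                  (∀ {x} → x ∈ S → r ≤ deg Γ x) → Term Γ D S (+ r)
    closed-term {S} {v} {r} closed conn v∈S deg≡r r≤deg =
      (v , v∈S) , conn , (r∈ , closed-alliance closed (v , v∈S) r≤deg , largest)
      where
      r∈ : Within D (+ r)
      r∈ = ℤP.neg-≤-pos , +≤+ (subst (_≤ D) deg≡r (deg≤D v))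
      largest : ∀ k′ → InK Γ D k′ → DefAlliance Γ S k′ → k′ ℤ.≤ + r
      largest k′ _ ally = subst (λ d → k′ ℤ.≤ + d) deg≡r (alliance-≤-deg ally v∈S)

    singleton-term : ∀ v → Term Γ D ⁅ v ⁆ (- + deg Γ v)
    singleton-term v =
      (v , x∈⁅x⁆ v) , singleton-connected v ,
      (v∈ , singleton-alliance v , λ _ _ ally → singleton-alliance-bound ally)
      where
      v∈ : Within D (- + deg Γ v)
      v∈ = ℤP.neg-mono-≤ (+≤+ (deg≤D v)) , ℤP.neg-≤-pos

    -- A connected set of exact index at most 1 - D is a single vertex: otherwise
    -- every vertex has a neighbour inside, making it a (2 - D)-alliance.
    low-index⇒singleton : ∀ {S k} → Term Γ D S k → k ℤ.≤ - + D ℤ.+ + 1 → ∃[ v ] (S ≡ ⁅ v ⁆)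
    low-index⇒singleton {S} {k} ((v , v∈S) , conn , (_ , _ , largest)) k≤1-D
      with singleton-or-other v∈S
    ... | inj₁ S≡⁅v⁆           = v , S≡⁅v⁆
    ... | inj₂ (u , u∈S , u≢v) =
      ⊥-elim (ℤP.<⇒≱ 1-D<2-D (ℤP.≤-trans (largest (shift D 2) 2-D∈ (neighbourly-alliance (v , v∈S) 1≤δ)) k≤1-D))
      where
      1≤δ : ∀ {x} → x ∈ S → 1 ≤ δ Γ S x
      1≤δ {x} x∈S with x ≟ᶠ v
      ... | yes refl = let (w , xw , w∈S) = connected⇒neighbour conn x∈S u∈S (λ x≡u → u≢v (≡-sym x≡u))
                       in δ-pos S x w xw w∈S
      ... | no x≢v   = let (w , xw , w∈S) = connected⇒neighbour conn x∈S v∈S x≢v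
                       in δ-pos S x w xw w∈S
      1≤D : 1 ≤ D
      1≤D = ℕP.≤-trans (1≤δ v∈S) (ℕP.≤-trans (δ≤deg S v) (deg≤D v))
      2-D∈ : Within D (shift D 2)
      2-D∈ = shift-within D 2 (ℕP.+-mono-≤ 1≤D 1≤D)
      1-D<2-D : - + D ℤ.+ + 1 ℤ.< shift D 2
      1-D<2-D = subst (ℤ._< shift D 2) (ℤP.+-comm (+ 1) (- + D)) (ℤP.+-monoˡ-< (- + D) (ℤ.+<+ ℕP.≤-refl))

    low-index-count : ∀ k → k ℤ.≤ - + D ℤ.+ + 1 → ∀ {m} →
                      HasCount (λ v → - + deg Γ v ≡ k) m → HasCount (ACounted Γ D k) m
    low-index-count k k≤1-D = HasCount-image ⁅_⁆ ⁅⁆-injective singletons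
      where
      singletons : ∀ S → ACounted Γ D k S ⇔ (∃[ v ] (- + deg Γ v ≡ k × S ≡ ⁅ v ⁆))
      singletons S = mk⇔ counted⇒singleton singleton⇒counted
        where
        counted⇒singleton : ACounted Γ D k S → ∃[ v ] (- + deg Γ v ≡ k × S ≡ ⁅ v ⁆)
        counted⇒singleton t with low-index⇒singleton t k≤1-D
        ... | v , refl = v , exact-index-unique (proj₂ (proj₂ (singleton-term v))) (proj₂ (proj₂ t)) , refl
        singleton⇒counted : ∃[ v ] (- + deg Γ v ≡ k × S ≡ ⁅ v ⁆) → ACounted Γ D k S
        singleton⇒counted (v , refl , refl) = singleton-term v

    lowest-exponent : ∀ {v} → deg Γ v ≡ D → IsDegMin Γ D (+ n ℤ.- + D)
    lowest-exponent {v} deg≡D =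
      (⁅ v ⁆ , - + D , subst (λ d → Term Γ D ⁅ v ⁆ (- + d)) deg≡D (singleton-term v) , refl) ,
      λ { _ (_ , _ , t , refl) → ℤP.+-monoʳ-≤ (+ n) (proj₁ (Term⇒within t)) }

    A-at-−D : ∃[ m ] (HasCount (ACounted Γ D (- (+ D))) m × HasCount (λ v → deg Γ v ≡ D) m)
    A-at-−D with count-vertices (λ v → deg Γ v ℕP.≟ D)
    ... | m , count = m , low-index-count (- + D) (ℤP.i≤i+j _ (+ 1)) (HasCount-⇔ negate count) , count
      where
      negate : ∀ v → deg Γ v ≡ D ⇔ - + deg Γ v ≡ - + D
      negate v = mk⇔ (cong (λ d → - + d)) (λ e → ℤP.+-injective (ℤP.neg-injective e))

    A-at-1−D : ∃[ m ] (HasCount (ACounted Γ D (- (+ D) ℤ.+ + 1)) m ×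
                       HasCount (λ v → + deg Γ v ≡ + D ℤ.- + 1) m)
    A-at-1−D with count-vertices (λ v → + deg Γ v ℤ.≟ + D ℤ.- + 1)
    ... | m , count = m , low-index-count (- + D ℤ.+ + 1) ℤP.≤-refl (HasCount-⇔ negate count) , count
      where
      negate-difference : ∀ i j → - (i ℤ.- j) ≡ - i ℤ.+ j
      negate-difference = solve-∀
      negate : ∀ v → + deg Γ v ≡ + D ℤ.- + 1 ⇔ - + deg Γ v ≡ - + D ℤ.+ + 1
      negate v = mk⇔ (λ e → trans (cong -_ e) (negate-difference (+ D) (+ 1)))
                     (λ e → ℤP.neg-injective (trans e (≡-sym (negate-difference (+ D) (+ 1)))))

    min-degree-term : ∀ {v₀ δₙ} → deg Γ v₀ ≡ δₙ → (∀ v → δₙ ≤ deg Γ v) →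
                      Term Γ D (component ⊤ v₀) (+ δₙ)
    min-degree-term {v₀} deg≡δₙ δₙ≤deg =
      closed-term (component-⊤-closed v₀) (component-connected ⊤ v₀) (component-root ⊤ v₀)
                  deg≡δₙ (λ {x} _ → δₙ≤deg x)

    attained⇒positive : ∀ {S k} → Term Γ D S k → ∃[ m ] (HasCount (ACounted Γ D k) m × 0 < m)
    attained⇒positive {k = k} t with count-subsets (λ S → Term? S k)
    ... | m , count = m , count , HasCount-pos count t

    degree : ∀ {S k₀} → Term Γ D S k₀ →
             ∃[ d ] (IsDeg Γ D d × (+ n ℤ.+ k₀ ℤ.≤ d) × (d ℤ.≤ + n ℤ.+ + D))
    degree {S} {k₀} t
      with max-within D (λ k → ∃[ S ] Term Γ D S k) (λ k → anySubset? (λ S → Term? S k))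
                      k₀ (Term⇒within t) (S , t)
    ... | k , (_ , k≤D) , (S′ , t′) , k₀≤k , largest =
      + n ℤ.+ k , ((S′ , k , t′ , refl) , highest) , ℤP.+-monoʳ-≤ (+ n) k₀≤k , ℤP.+-monoʳ-≤ (+ n) k≤D
      where
      highest : ∀ e → Exponent Γ D e → e ℤ.≤ + n ℤ.+ k
      highest _ (S″ , k″ , t″ , refl) = ℤP.+-monoʳ-≤ (+ n) (largest k″ (Term⇒within t″) (S″ , t″))

    -- (v) S has exact index D exactly when it is a D-regular component: at index D
    -- the inequality δ_S̄ + D ≤ δ_S ≤ deg ≤ D forces δ_S̄ = 0 and deg = D.
    top-index⇔regular-component : ∀ S → Term Γ D S (+ D) ⇔ RegularComponent Γ D S
    top-index⇔regular-component S = mk⇔ top⇒regular regular⇒top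
      where
      top⇒regular : Term Γ D S (+ D) → RegularComponent Γ D S
      top⇒regular (ne , conn , _ , (_ , ally) , _) =
        closed-connected⇒component ne conn closed , regular
        where
        squeeze : ∀ {x} → x ∈ S → δ Γ (∁ S) x + D ≤ deg Γ x
        squeeze {x} x∈S = ℕP.≤-trans (ℤP.drop‿+≤+ (ally x x∈S)) (δ≤deg S x)
        closed : Closed S
        closed = δ-outside≡0⇒closed λ {x} x∈S →
          ℕP.n≤0⇒n≡0 (ℕP.+-cancelʳ-≤ D _ 0 (ℕP.≤-trans (squeeze x∈S) (deg≤D x)))
        regular : ∀ x → x ∈ S → deg Γ x ≡ D
        regular x x∈S = ℕP.≤-antisym (deg≤D x) (ℕP.≤-trans (ℕP.m≤n+m D _) (squeeze x∈S))
      regular⇒top : RegularComponent Γ D S → Term Γ D S (+ D)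
      regular⇒top (isComponent@((v , v∈S) , conn , _) , regular) =
        closed-term (component-closed isComponent) conn v∈S (regular v v∈S)
                    (λ {x} x∈S → ℕP.≤-reflexive (≡-sym (regular x x∈S)))

    A-at-D : ∃[ m ] (HasCount (ACounted Γ D (+ D)) m × HasCount (RegularComponent Γ D) m)
    A-at-D with count-subsets (λ S → Term? S (+ D))
    ... | m , count = m , count , HasCount-⇔ top-index⇔regular-component count

    -- (vi) A k-alliance S with k beyond Deg - n restricts to a connected k-alliance T,
    -- whose exact index k_T ≥ k would give an exponent n + k_T above the degree.
    no-alliance-above-degree : ∀ d → IsDeg Γ D d → ∀ k → d ℤ.- + n ℤ.< k →
                               ∀ S → ¬ DefAlliance Γ S k
    no-alliance-above-degree d (_ , highest) k d-n<k S ally@((v , v∈S) , _)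
      with exact-index (v , component-root S v)
    ... | kT , exactT@((-D≤kT , _) , _ , largest) = ℤP.<⇒≱ kT<k k≤kT
      where
      T = component S v
      cancel : ∀ N K → (N ℤ.+ K) ℤ.- N ≡ K
      cancel = solve-∀
      kT≤d-n : kT ℤ.≤ d ℤ.- + n
      kT≤d-n = subst (ℤ._≤ d ℤ.- + n) (cancel (+ n) kT)
        (ℤP.+-monoˡ-≤ (- + n) (highest _ (T , kT , ((v , component-root S v) , component-connected S v , exactT) , refl)))
      kT<k : kT ℤ.< k
      kT<k = ℤP.≤-<-trans kT≤d-n d-n<k
      k≤kT : k ℤ.≤ kT
      k≤kT = largest k (ℤP.≤-trans -D≤kT (ℤP.<⇒≤ kT<k) , alliance-≤-D {S} {k} ally) (component-alliance {S} {k} ally v∈S)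

-- Parts (i), (ii), (v), (vi) are the lemmas above for D = δ₁; parts (iii) and (iv)
-- come from the component of a vertex of minimum degree.
theorem2p5 : (n : ℕ) → 0 < n → (Γ : Graph n) → (δ₁ δₙ : ℕ) →
    IsMaxDeg Γ δ₁ → IsMinDeg Γ δₙ →
      (IsDegMin Γ δ₁ (+ n ℤ.- + δ₁)
        × (∃[ m ] (HasCount (ACounted Γ δ₁ (- (+ δ₁))) m
                   × HasCount (λ v → deg Γ v ≡ δ₁) m)))
      × (∃[ m ] (HasCount (ACounted Γ δ₁ (- (+ δ₁) ℤ.+ + 1)) m
                 × HasCount (λ v → + deg Γ v ≡ + δ₁ ℤ.- + 1) m))
      × (∃[ m ] (HasCount (ACounted Γ δ₁ (+ δₙ)) m × 0 < m))
      × (∃[ d ] (IsDeg Γ δ₁ d × (+ n ℤ.+ + δₙ ℤ.≤ d) × (d ℤ.≤ + n ℤ.+ + δ₁)))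
      × (∃[ m ] (HasCount (ACounted Γ δ₁ (+ δ₁)) m
                 × HasCount (RegularComponent Γ δ₁) m))
      × (∀ d → IsDeg Γ δ₁ d → ∀ k → d ℤ.- + n ℤ.< k →
           ∀ S → ¬ DefAlliance Γ S k)
theorem2p5 n _ Γ δ₁ δₙ ((v₁ , deg-v₁) , deg≤δ₁) ((v₀ , deg-v₀) , δₙ≤deg) =
  (lowest-exponent deg-v₁ , A-at-−D) , A-at-1−D ,
  attained⇒positive component-term , degree component-term ,
  A-at-D , no-alliance-above-degree
  where
  open Alliances Γ
  open MaxDegree δ₁ deg≤δ₁
  component-term : Term Γ δ₁ (Walks.component Γ ⊤ v₀) (+ δₙ)
  component-term = min-degree-term deg-v₀ δₙ≤deg
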